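{- For nonnegative integers $r$ and $s$, $\mathrm{HWP}^{*}(8; 4^{r}, 8^{s})$ has a solution if and only if $r+s=7$.
   Context: $K_v^*$ denotes the complete symmetric digraph of order $v$ (both arcs $(x,y)$ and $(y,x)$ for all distinct vertices $x,y$). A directed $C_k$-factor of a digraph is a spanning subdigraph that is a vertex-disjoint union of directed $k$-cycles. $\mathrm{HWP}^{*}(v; m^{r}, n^{s})$ has a solution if the arc set of $K_v^*$ can be partitioned into $r$ directed $C_m$-factors and $s$ directed $C_n$-factors. -}

module Defs where

open import Data.Nat using (ℕ; zero; suc; _<_)
open import Data.Fin using (Fin)
open import Data.Sum using (_⊎_)
open import Data.Product using (Σ; _×_)
open import Relation.Binary.PropositionalEquality using (_≡_; _≢_)

iter : {A : Set} → (A → A) → ℕ → A → A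
iter f zero    x = x
iter f (suc n) x = f (iter f n x)

-- A directed C_k-factor of K_v^* on vertex set Fin v, given by its
-- successor map: vertex x has the unique out-arc (x , next x).
-- Every vertex lies on a directed cycle of length exactly k
-- (next^k x = x and next^j x ≠ x for 0 < j < k), so the factor is a
-- vertex-disjoint union of directed k-cycles spanning all vertices.
record DiCycleFactor (v k : ℕ) : Set where
  field
    next    : Fin v → Fin v
    closes  : ∀ x → iter next k x ≡ x
    minimal : ∀ x (j : ℕ) → 0 < j → j < k → iter next j x ≢ x

open DiCycleFactor public

ArcOf : ∀ {v k} → DiCycleFactor v k → Fin v → Fin v → Set
ArcOf F x y = next F x ≡ y

-- HWP*(v; m^r, n^s) has a solution: there are r directed C_m-factors and
-- s directed C_n-factors (indexed by Fin r ⊎ Fin s) such that every arc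
-- (x , y), x ≠ y, of K_v^* lies in exactly one of them.
-- (Loops never lie in a factor when m, n ≥ 2, by `minimal` with j = 1.)
HWP* : (v m r n s : ℕ) → Set
HWP* v m r n s =
  Σ (Fin r → DiCycleFactor v m) λ Fm →
  Σ (Fin s → DiCycleFactor v n) λ Fn →
  let inFactor : Fin r ⊎ Fin s → Fin v → Fin v → Set
      inFactor = λ { (_⊎_.inj₁ i) x y → ArcOf (Fm i) x y
                   ; (_⊎_.inj₂ j) x y → ArcOf (Fn j) x y } in
  ∀ (x y : Fin v) → x ≢ y →
    Σ (Fin r ⊎ Fin s) λ i → inFactor i x y × (∀ i′ → inFactor i′ x y → i′ ≡ i)

module Submission where

open import Defs
open import Data.Nat using (ℕ; zero; suc; _+_; _<_; _<?_; s≤s; z≤n)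
open import Data.Fin using (Fin; zero; suc; #_; toℕ; fromℕ<; join; splitAt; punchOut; _≟_)
open import Data.Fin.Properties
  using (all?; any?; toℕ-fromℕ<; splitAt-join; join-splitAt; punchOut-injective; suc-injective;
         cantor-schröder-bernstein)
open import Data.Vec using (Vec; []; _∷_; lookup)
open import Data.Sum using (_⊎_; inj₁; inj₂; [_,_]; [_,_]′)
open import Data.Sum.Properties using (≡-dec)
open import Data.Product using (_×_; _,_; ∃; proj₁; proj₂; uncurry)
open import Function using (_∘_; case_of_)
open import Function.Bundles using (_⇔_; mk⇔)
open import Relation.Binary.PropositionalEquality
  using (_≡_; _≢_; refl; sym; trans; cong; subst; ≢-sym; module ≡-Reasoning)
open import Relation.Nullary using (Dec; ¬?; contradiction)
open import Relation.Nullary.Decidable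
  using (map′; _×-dec_; _⊎-dec_; _→-dec_; True; toWitness)

-- Every directed cycle factor contains exactly one out-arc of vertex 0, and
-- each of the 7 out-arcs of vertex 0 in K₈* lies in exactly one factor, so a
-- solution has exactly 7 factors.  Conversely, for each r + s = 7 an explicit
-- solution, given by the successor tables of its factors, is checked by
-- evaluation.

next≢self : ∀ {v k} → 1 < k → (F : DiCycleFactor v k) → ∀ x → next F x ≢ x
next≢self 1<k F x = minimal F x 1 (s≤s z≤n) 1<k

HWP*-factorCount : ∀ {v m r n s} → 1 < m → 1 < n → HWP* (suc v) m r n s → r + s ≡ v
HWP*-factorCount {v} {m} {r} {n} {s} 1<m 1<n (Fm , Fn , decomposes) =
  cantor-schröder-bernstein {f = outNeighbour} {g = factorOf} outNeighbour-injective factorOf-injective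
  where
  Factor : Set
  Factor = Fin r ⊎ Fin s

  out : Factor → Fin (suc v)
  out = [ (λ i → next (Fm i) zero) , (λ j → next (Fn j) zero) ]′

  zero≢out : ∀ u → zero ≢ out u
  zero≢out (inj₁ i) = ≢-sym (next≢self 1<m (Fm i) zero)
  zero≢out (inj₂ j) = ≢-sym (next≢self 1<n (Fn j) zero)

  owner : ∀ y → zero ≢ y → Factor
  owner y zero≢y = proj₁ (decomposes zero y zero≢y)

  owner-unique : ∀ y (zero≢y : zero ≢ y) u → out u ≡ y → u ≡ owner y zero≢y
  owner-unique y zero≢y (inj₁ i) = proj₂ (proj₂ (decomposes zero y zero≢y)) (inj₁ i)
  owner-unique y zero≢y (inj₂ j) = proj₂ (proj₂ (decomposes zero y zero≢y)) (inj₂ j)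

  out-owner : ∀ y (zero≢y : zero ≢ y) → out (owner y zero≢y) ≡ y
  out-owner y zero≢y with decomposes zero y zero≢y
  ... | inj₁ i , e , _ = e
  ... | inj₂ j , e , _ = e

  out-injective : ∀ u u′ → out u ≡ out u′ → u ≡ u′
  out-injective u u′ e =
    trans (owner-unique _ (zero≢out u′) u e) (sym (owner-unique _ (zero≢out u′) u′ refl))

  ownerOfSuc : Fin v → Factor
  ownerOfSuc t = owner (suc t) λ ()

  outNeighbour : Fin (r + s) → Fin v
  outNeighbour k = punchOut (zero≢out (splitAt r k))

  factorOf : Fin v → Fin (r + s)
  factorOf t = join r s (ownerOfSuc t)

  outNeighbour-injective : ∀ {k k′} → outNeighbour k ≡ outNeighbour k′ → k ≡ k′
  outNeighbour-injective {k} {k′} e = begin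
    k                        ≡⟨ sym (join-splitAt r s k) ⟩
    join r s (splitAt r k)   ≡⟨ cong (join r s) (out-injective (splitAt r k) (splitAt r k′)
                                  (punchOut-injective (zero≢out (splitAt r k)) (zero≢out (splitAt r k′)) e)) ⟩
    join r s (splitAt r k′)  ≡⟨ join-splitAt r s k′ ⟩
    k′                       ∎
    where open ≡-Reasoning

  factorOf-injective : ∀ {t t′} → factorOf t ≡ factorOf t′ → t ≡ t′
  factorOf-injective {t} {t′} e = suc-injective (begin
    suc t                                      ≡⟨ sym (out-owner (suc t) λ ()) ⟩
    out (ownerOfSuc t)                         ≡⟨ cong out (sym (splitAt-join r s (ownerOfSuc t))) ⟩
    out (splitAt r (join r s (ownerOfSuc t)))  ≡⟨ cong (out ∘ splitAt r) e ⟩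
    out (splitAt r (join r s (ownerOfSuc t′))) ≡⟨ cong out (splitAt-join r s (ownerOfSuc t′)) ⟩
    out (ownerOfSuc t′)                        ≡⟨ out-owner (suc t′) (λ ()) ⟩
    suc t′                                     ∎)
    where open ≡-Reasoning

-- The fields of DiCycleFactor with j ranging over Fin k, so that it is decidable.
IsCycleFactor : ∀ {v} → ℕ → (Fin v → Fin v) → Set
IsCycleFactor k f = (∀ x → iter f k x ≡ x) × (∀ x (j : Fin k) → 0 < toℕ j → iter f (toℕ j) x ≢ x)

isCycleFactor? : ∀ {v} k (f : Fin v → Fin v) → Dec (IsCycleFactor k f)
isCycleFactor? k f =
  all? (λ x → iter f k x ≟ x) ×-dec
  all? (λ x → all? λ j → (0 <? toℕ j) →-dec ¬? (iter f (toℕ j) x ≟ x))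

cycleFactor : ∀ {v k} (f : Fin v → Fin v) → IsCycleFactor k f → DiCycleFactor v k
cycleFactor f (closes , minimal) = record
  { next    = f
  ; closes  = closes
  ; minimal = λ x j 0<j j<k →
      subst (λ i → iter f i x ≢ x) (toℕ-fromℕ< j<k)
            (minimal x (fromℕ< j<k) (subst (0 <_) (sym (toℕ-fromℕ< j<k)) 0<j))
  }

module _ {a b p} {A : Set a} {B : Set b} {P : A ⊎ B → Set p} where

  all⊎? : Dec (∀ x → P (inj₁ x)) → Dec (∀ y → P (inj₂ y)) → Dec (∀ u → P u)
  all⊎? P₁? P₂? = map′ (uncurry [_,_]) (λ ∀P → ∀P ∘ inj₁ , ∀P ∘ inj₂) (P₁? ×-dec P₂?)

  any⊎? : Dec (∃ (P ∘ inj₁)) → Dec (∃ (P ∘ inj₂)) → Dec (∃ P)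
  any⊎? P₁? P₂? = map′
    [ (λ (x , px) → inj₁ x , px) , (λ (y , py) → inj₂ y , py) ]′
    (λ { (inj₁ x , px) → inj₁ (x , px) ; (inj₂ y , py) → inj₂ (y , py) })
    (P₁? ⊎-dec P₂?)

module _ {v r s : ℕ} (m n : ℕ) (A : Fin r → Fin v → Fin v) (B : Fin s → Fin v → Fin v) where

  private
    successor : Fin r ⊎ Fin s → Fin v → Fin v
    successor = [ A , B ]′

    allFactors? : {P : Fin r ⊎ Fin s → Set} → (∀ u → Dec (P u)) → Dec (∀ u → P u)
    allFactors? P? = all⊎? (all? (P? ∘ inj₁)) (all? (P? ∘ inj₂))

    anyFactor? : {P : Fin r ⊎ Fin s → Set} → (∀ u → Dec (P u)) → Dec (∃ P)
    anyFactor? P? = any⊎? (any? (P? ∘ inj₁)) (any? (P? ∘ inj₂))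

  IsSolution : Set
  IsSolution =
    (∀ i → IsCycleFactor m (A i)) × (∀ j → IsCycleFactor n (B j)) ×
    (∀ x u u′ → successor u x ≡ successor u′ x → u ≡ u′) ×
    (∀ x y → x ≡ y ⊎ ∃ λ u → successor u x ≡ y)

  isSolution? : Dec IsSolution
  isSolution? =
    all? (isCycleFactor? m ∘ A) ×-dec all? (isCycleFactor? n ∘ B) ×-dec
    all? (λ x → allFactors? λ u → allFactors? λ u′ →
                  (successor u x ≟ successor u′ x) →-dec ≡-dec _≟_ _≟_ u u′) ×-dec
    all? (λ x → all? λ y → (x ≟ y) ⊎-dec anyFactor? λ u → successor u x ≟ y)

  isSolution⇒HWP* : IsSolution → HWP* v m r n s
  isSolution⇒HWP* (A-cycles , B-cycles , successor-injective , covered) =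
    (λ i → cycleFactor (A i) (A-cycles i)) , (λ j → cycleFactor (B j) (B-cycles j)) ,
    λ x y x≢y → case covered x y of λ where
      (inj₁ x≡y)          → contradiction x≡y x≢y
      (inj₂ (inj₁ i , e)) → inj₁ i , e , λ where
        (inj₁ i′) e′ → successor-injective x _ _ (trans e′ (sym e))
        (inj₂ j′) e′ → successor-injective x _ _ (trans e′ (sym e))
      (inj₂ (inj₂ j , e)) → inj₂ j , e , λ where
        (inj₁ i′) e′ → successor-injective x _ _ (trans e′ (sym e))
        (inj₂ j′) e′ → successor-injective x _ _ (trans e′ (sym e))

  checkedSolution : True isSolution? → HWP* v m r n s
  checkedSolution = isSolution⇒HWP* ∘ toWitness

table : ∀ {r v} → Vec (Vec (Fin v) v) r → Fin r → Fin v → Fin v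
table T i x = lookup (lookup T i) x

solution : ∀ r s → r + s ≡ 7 → HWP* 8 4 r 8 s
solution 0 .7 refl = checkedSolution 4 8
  (table [])
  (table ( (# 1 ∷ # 3 ∷ # 7 ∷ # 5 ∷ # 2 ∷ # 4 ∷ # 0 ∷ # 6 ∷ [])
         ∷ (# 4 ∷ # 2 ∷ # 5 ∷ # 0 ∷ # 7 ∷ # 6 ∷ # 3 ∷ # 1 ∷ [])
         ∷ (# 6 ∷ # 5 ∷ # 1 ∷ # 2 ∷ # 3 ∷ # 0 ∷ # 7 ∷ # 4 ∷ [])
         ∷ (# 2 ∷ # 7 ∷ # 6 ∷ # 1 ∷ # 5 ∷ # 3 ∷ # 4 ∷ # 0 ∷ [])
         ∷ (# 7 ∷ # 4 ∷ # 3 ∷ # 6 ∷ # 0 ∷ # 2 ∷ # 1 ∷ # 5 ∷ [])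
         ∷ (# 3 ∷ # 0 ∷ # 4 ∷ # 7 ∷ # 6 ∷ # 1 ∷ # 5 ∷ # 2 ∷ [])
         ∷ (# 5 ∷ # 6 ∷ # 0 ∷ # 4 ∷ # 1 ∷ # 7 ∷ # 2 ∷ # 3 ∷ [])
         ∷ []))
  _
solution 1 .6 refl = checkedSolution 4 8
  (table ( (# 3 ∷ # 7 ∷ # 4 ∷ # 1 ∷ # 6 ∷ # 2 ∷ # 5 ∷ # 0 ∷ [])
         ∷ []))
  (table ( (# 5 ∷ # 0 ∷ # 1 ∷ # 4 ∷ # 7 ∷ # 3 ∷ # 2 ∷ # 6 ∷ [])
         ∷ (# 1 ∷ # 4 ∷ # 0 ∷ # 2 ∷ # 5 ∷ # 6 ∷ # 7 ∷ # 3 ∷ [])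
         ∷ (# 7 ∷ # 3 ∷ # 5 ∷ # 6 ∷ # 1 ∷ # 4 ∷ # 0 ∷ # 2 ∷ [])
         ∷ (# 4 ∷ # 6 ∷ # 7 ∷ # 0 ∷ # 2 ∷ # 1 ∷ # 3 ∷ # 5 ∷ [])
         ∷ (# 2 ∷ # 5 ∷ # 6 ∷ # 7 ∷ # 3 ∷ # 0 ∷ # 4 ∷ # 1 ∷ [])
         ∷ (# 6 ∷ # 2 ∷ # 3 ∷ # 5 ∷ # 0 ∷ # 7 ∷ # 1 ∷ # 4 ∷ [])
         ∷ []))
  _
solution 2 .5 refl = checkedSolution 4 8
  (table ( (# 7 ∷ # 2 ∷ # 5 ∷ # 1 ∷ # 0 ∷ # 3 ∷ # 4 ∷ # 6 ∷ [])
         ∷ (# 1 ∷ # 5 ∷ # 0 ∷ # 6 ∷ # 3 ∷ # 2 ∷ # 7 ∷ # 4 ∷ [])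
         ∷ []))
  (table ( (# 3 ∷ # 6 ∷ # 4 ∷ # 2 ∷ # 7 ∷ # 0 ∷ # 5 ∷ # 1 ∷ [])
         ∷ (# 5 ∷ # 4 ∷ # 7 ∷ # 0 ∷ # 6 ∷ # 1 ∷ # 2 ∷ # 3 ∷ [])
         ∷ (# 6 ∷ # 0 ∷ # 1 ∷ # 7 ∷ # 2 ∷ # 4 ∷ # 3 ∷ # 5 ∷ [])
         ∷ (# 4 ∷ # 3 ∷ # 6 ∷ # 5 ∷ # 1 ∷ # 7 ∷ # 0 ∷ # 2 ∷ [])
         ∷ (# 2 ∷ # 7 ∷ # 3 ∷ # 4 ∷ # 5 ∷ # 6 ∷ # 1 ∷ # 0 ∷ [])
         ∷ []))
  _
solution 3 .4 refl = checkedSolution 4 8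
  (table ( (# 5 ∷ # 6 ∷ # 4 ∷ # 2 ∷ # 7 ∷ # 1 ∷ # 0 ∷ # 3 ∷ [])
         ∷ (# 4 ∷ # 7 ∷ # 1 ∷ # 0 ∷ # 6 ∷ # 2 ∷ # 3 ∷ # 5 ∷ [])
         ∷ (# 6 ∷ # 0 ∷ # 5 ∷ # 4 ∷ # 2 ∷ # 3 ∷ # 7 ∷ # 1 ∷ [])
         ∷ []))
  (table ( (# 2 ∷ # 4 ∷ # 3 ∷ # 5 ∷ # 0 ∷ # 7 ∷ # 1 ∷ # 6 ∷ [])
         ∷ (# 1 ∷ # 3 ∷ # 0 ∷ # 7 ∷ # 5 ∷ # 6 ∷ # 2 ∷ # 4 ∷ [])
         ∷ (# 7 ∷ # 5 ∷ # 6 ∷ # 1 ∷ # 3 ∷ # 0 ∷ # 4 ∷ # 2 ∷ [])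
         ∷ (# 3 ∷ # 2 ∷ # 7 ∷ # 6 ∷ # 1 ∷ # 4 ∷ # 5 ∷ # 0 ∷ [])
         ∷ []))
  _
solution 4 .3 refl = checkedSolution 4 8
  (table ( (# 4 ∷ # 7 ∷ # 6 ∷ # 0 ∷ # 5 ∷ # 3 ∷ # 1 ∷ # 2 ∷ [])
         ∷ (# 5 ∷ # 0 ∷ # 1 ∷ # 7 ∷ # 3 ∷ # 2 ∷ # 4 ∷ # 6 ∷ [])
         ∷ (# 3 ∷ # 4 ∷ # 7 ∷ # 6 ∷ # 2 ∷ # 0 ∷ # 5 ∷ # 1 ∷ [])
         ∷ (# 7 ∷ # 3 ∷ # 4 ∷ # 2 ∷ # 1 ∷ # 6 ∷ # 0 ∷ # 5 ∷ [])
         ∷ []))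
  (table ( (# 2 ∷ # 6 ∷ # 3 ∷ # 5 ∷ # 0 ∷ # 1 ∷ # 7 ∷ # 4 ∷ [])
         ∷ (# 6 ∷ # 2 ∷ # 5 ∷ # 1 ∷ # 7 ∷ # 4 ∷ # 3 ∷ # 0 ∷ [])
         ∷ (# 1 ∷ # 5 ∷ # 0 ∷ # 4 ∷ # 6 ∷ # 7 ∷ # 2 ∷ # 3 ∷ [])
         ∷ []))
  _
solution 5 .2 refl = checkedSolution 4 8
  (table ( (# 6 ∷ # 3 ∷ # 7 ∷ # 2 ∷ # 0 ∷ # 4 ∷ # 5 ∷ # 1 ∷ [])
         ∷ (# 7 ∷ # 0 ∷ # 3 ∷ # 6 ∷ # 2 ∷ # 1 ∷ # 4 ∷ # 5 ∷ [])
         ∷ (# 4 ∷ # 2 ∷ # 0 ∷ # 5 ∷ # 1 ∷ # 6 ∷ # 7 ∷ # 3 ∷ [])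
         ∷ (# 2 ∷ # 5 ∷ # 1 ∷ # 4 ∷ # 7 ∷ # 0 ∷ # 3 ∷ # 6 ∷ [])
         ∷ (# 1 ∷ # 4 ∷ # 5 ∷ # 7 ∷ # 6 ∷ # 3 ∷ # 0 ∷ # 2 ∷ [])
         ∷ []))
  (table ( (# 5 ∷ # 7 ∷ # 6 ∷ # 0 ∷ # 3 ∷ # 2 ∷ # 1 ∷ # 4 ∷ [])
         ∷ (# 3 ∷ # 6 ∷ # 4 ∷ # 1 ∷ # 5 ∷ # 7 ∷ # 2 ∷ # 0 ∷ [])
         ∷ []))
  _
solution 6 .1 refl = checkedSolution 4 8
  (table ( (# 6 ∷ # 4 ∷ # 0 ∷ # 2 ∷ # 5 ∷ # 7 ∷ # 3 ∷ # 1 ∷ [])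
         ∷ (# 1 ∷ # 2 ∷ # 7 ∷ # 6 ∷ # 3 ∷ # 4 ∷ # 5 ∷ # 0 ∷ [])
         ∷ (# 3 ∷ # 5 ∷ # 4 ∷ # 1 ∷ # 6 ∷ # 0 ∷ # 7 ∷ # 2 ∷ [])
         ∷ (# 4 ∷ # 3 ∷ # 1 ∷ # 5 ∷ # 7 ∷ # 2 ∷ # 0 ∷ # 6 ∷ [])
         ∷ (# 7 ∷ # 6 ∷ # 5 ∷ # 4 ∷ # 0 ∷ # 1 ∷ # 2 ∷ # 3 ∷ [])
         ∷ (# 5 ∷ # 0 ∷ # 3 ∷ # 7 ∷ # 2 ∷ # 6 ∷ # 1 ∷ # 4 ∷ [])
         ∷ []))
  (table ( (# 2 ∷ # 7 ∷ # 6 ∷ # 0 ∷ # 1 ∷ # 3 ∷ # 4 ∷ # 5 ∷ [])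
         ∷ []))
  _
solution 7 .0 refl = checkedSolution 4 8
  (table ( (# 2 ∷ # 5 ∷ # 6 ∷ # 4 ∷ # 1 ∷ # 3 ∷ # 7 ∷ # 0 ∷ [])
         ∷ (# 3 ∷ # 6 ∷ # 4 ∷ # 1 ∷ # 5 ∷ # 7 ∷ # 0 ∷ # 2 ∷ [])
         ∷ (# 7 ∷ # 4 ∷ # 0 ∷ # 5 ∷ # 3 ∷ # 1 ∷ # 2 ∷ # 6 ∷ [])
         ∷ (# 4 ∷ # 2 ∷ # 3 ∷ # 6 ∷ # 7 ∷ # 0 ∷ # 1 ∷ # 5 ∷ [])
         ∷ (# 5 ∷ # 0 ∷ # 1 ∷ # 7 ∷ # 6 ∷ # 2 ∷ # 3 ∷ # 4 ∷ [])
         ∷ (# 1 ∷ # 7 ∷ # 5 ∷ # 0 ∷ # 2 ∷ # 6 ∷ # 4 ∷ # 3 ∷ [])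
         ∷ (# 6 ∷ # 3 ∷ # 7 ∷ # 2 ∷ # 0 ∷ # 4 ∷ # 5 ∷ # 1 ∷ [])
         ∷ []))
  (table [])
  _

lemma3p5 : (r s : ℕ) → HWP* 8 4 r 8 s ⇔ (r + s ≡ 7)
lemma3p5 r s = mk⇔ (HWP*-factorCount (s≤s (s≤s z≤n)) (s≤s (s≤s z≤n))) (solution r s)
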